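{- Let $G$ be a weak framework for a matroid $M$ and let $e$ be a loop-edge of $G$. If $e$ is not a loop of $M$, then $G\circ e$ is a weak framework for $M/e$.
   Context: For a graph $G$ and a vertex $v$, $\mathrm{loops}_G(v)$ denotes the set of loop-edges of $G$ at $v$. Graphs are finite and may have loops and parallel edges. A graph $G$ is a weak framework for a matroid $M$ if (1) $E(G)=E(M)$; (2) $r_M(E(H))\le |V(H)|$ for each component $H$ of $G$; and (3) for each vertex $v$ of $G$, $\mathrm{cl}_M(E(G-v))\subseteq E(G-v)\cup \mathrm{loops}_G(v)$. If $e$ is a loop-edge of $G$ at a vertex $v$, then $G\circ e$ denotes a graph obtained from $G-v$ by adding, for each non-loop edge $f=vw$ of $G$, the edge $f$ as a loop-edge at $w$, and then adding each loop-edge $f\neq e$ of $G$ at $v$ as a loop-edge at an arbitrary vertex. -}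

module Defs where

open import Data.Nat using (ℕ; _≤_; _+_; _∸_)
open import Data.Bool using (Bool; true; false; _∧_; _∨_; not)
open import Data.Fin using (Fin)
open import Data.Fin.Subset using (Subset; _∈_; _∉_; _⊆_; _∪_; _∩_; _-_; ⁅_⁆; ∣_∣; Nonempty; inside; outside)
open import Data.Vec using (lookup; tabulate)
open import Data.Product using (_×_; _,_; proj₁; proj₂; Σ; ∃)
open import Data.Sum using (_⊎_)
open import Relation.Binary.PropositionalEquality using (_≡_; _≢_)
open import Relation.Nullary using (¬_)

record RawMatroid (m : ℕ) : Set where
  field
    ground : Subset m
    rank   : Subset m → ℕ
open RawMatroid public

record IsMatroid {m : ℕ} (M : RawMatroid m) : Set where
  field
    rank-≤-card : ∀ X → X ⊆ ground M → rank M X ≤ ∣ X ∣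
    rank-mono   : ∀ X Y → Y ⊆ ground M → X ⊆ Y → rank M X ≤ rank M Y
    rank-submod : ∀ X Y → X ⊆ ground M → Y ⊆ ground M →
                  rank M (X ∪ Y) + rank M (X ∩ Y) ≤ rank M X + rank M Y

InClosure : ∀ {m} → RawMatroid m → Subset m → Fin m → Set
InClosure M X x = x ∈ ground M × rank M (X ∪ ⁅ x ⁆) ≡ rank M X

IsMatroidLoop : ∀ {m} → RawMatroid m → Fin m → Set
IsMatroidLoop M e = e ∈ ground M × rank M ⁅ e ⁆ ≡ 0

contract : ∀ {m} → RawMatroid m → Fin m → RawMatroid m
contract M e = record
  { ground = ground M - e
  ; rank   = λ X → rank M (X ∪ ⁅ e ⁆) ∸ rank M ⁅ e ⁆ }

-- Graphs (loops and parallel edges allowed) with vertex set ⊆ Fin n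
-- and edge set ⊆ Fin m.  Each edge f has an (unordered) pair of ends
-- given by  ends f ; f is a loop-edge iff both ends coincide.

record Graph (n m : ℕ) : Set where
  field
    verts     : Subset n
    edges     : Subset m
    ends      : Fin m → Fin n × Fin n
    ends-verts : ∀ f → f ∈ edges →
                 proj₁ (ends f) ∈ verts × proj₂ (ends f) ∈ verts
open Graph public

Incident : ∀ {n m} → Graph n m → Fin m → Fin n → Set
Incident G f v = proj₁ (ends G f) ≡ v ⊎ proj₂ (ends G f) ≡ v

IsLoopAt : ∀ {n m} → Graph n m → Fin m → Fin n → Set
IsLoopAt G f v = f ∈ edges G × proj₁ (ends G f) ≡ v × proj₂ (ends G f) ≡ v

Joins : ∀ {n m} → Graph n m → Fin m → Fin n → Fin n → Set
Joins G f u w = f ∈ edges G ×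
  ((proj₁ (ends G f) ≡ u × proj₂ (ends G f) ≡ w) ⊎
   (proj₁ (ends G f) ≡ w × proj₂ (ends G f) ≡ u))

data Reach {n m} (G : Graph n m) : Fin n → Fin n → Set where
  here : ∀ {u} → u ∈ verts G → Reach G u u
  step : ∀ {u w x} (f : Fin m) → Joins G f u w → Reach G w x → Reach G u x

IsComponent : ∀ {n m} → Graph n m → Subset n → Set
IsComponent {n} {m} G C =
  C ⊆ verts G × Nonempty C ×
  (∀ u w → u ∈ C → w ∈ C → Reach G u w) ×
  (∀ (f : Fin m) u w → Joins G f u w → u ∈ C → w ∈ C)

IsEdgeSetOn : ∀ {n m} → Graph n m → Subset n → Subset m → Set
IsEdgeSetOn {n} {m} G C X =
  ∀ (f : Fin m) → (f ∈ X → f ∈ edges G × proj₁ (ends G f) ∈ C × proj₂ (ends G f) ∈ C)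
                × (f ∈ edges G → proj₁ (ends G f) ∈ C → proj₂ (ends G f) ∈ C → f ∈ X)

IsEdgeSetDel : ∀ {n m} → Graph n m → Fin n → Subset m → Set
IsEdgeSetDel {n} {m} G v X =
  ∀ (f : Fin m) → (f ∈ X → f ∈ edges G × ¬ Incident G f v)
                × (f ∈ edges G → ¬ Incident G f v → f ∈ X)

record IsWeakFramework {n m} (G : Graph n m) (M : RawMatroid m) : Set where
  field
    same-edges : edges G ≡ ground M
    component-rank : ∀ C X → IsComponent G C → IsEdgeSetOn G C X →
                     rank M X ≤ ∣ C ∣
    closure-cond : ∀ v X → v ∈ verts G → IsEdgeSetDel G v X →
                   ∀ x → InClosure M X x → x ∈ X ⊎ IsLoopAt G x v

record IsCirc {n m} (G : Graph n m) (e : Fin m) (v : Fin n) (G' : Graph n m) : Set where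
  field
    verts-eq : verts G' ≡ verts G - v
    edges-eq : edges G' ≡ edges G - e
    keep     : ∀ f → f ∈ edges G → ¬ Incident G f v →
               ∀ a b → Joins G f a b → Joins G' f a b
    to-loop  : ∀ f w → Joins G f v w → w ≢ v → IsLoopAt G' f w
    move-loop : ∀ f → IsLoopAt G f v → f ≢ e → ∃ λ u → IsLoopAt G' f u

-- Rank condition for a component C of G ∘ e: in G the edges of C, together with e, are
-- induced by the vertex set C ∪ {v}, and in a weak framework the edges induced by any vertex
-- set S have rank at most |S|.  For the latter, enlarge S along edges until it is a union of
-- components; by condition (3) each edge leading to a new vertex b is not spanned by the edges
-- of G - b, so every added vertex raises the rank.  Contracting the non-loop e then lowers the
-- rank by one.  Closure condition at a vertex u of G ∘ e: cl_{M/e}(X) ⊆ cl_M(X ∪ e), so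
-- condition (3) of G at u applies, and the only edges that become incident with u in passing
-- from G to G ∘ e are loops at u.
module Submission where

open import Defs
open import Data.Nat using (ℕ; suc; _+_; _≤_; _<_; z≤n; s≤s)
open import Data.Nat.Properties as ℕ using (module ≤-Reasoning)
open import Data.Bool using (true; false)
open import Data.Fin using (Fin; zero; suc)
open import Data.Fin.Properties using (_≟_; any?)
open import Data.Fin.Subset
  using (Subset; _∈_; _∉_; _⊆_; _⊂_; _⊃_; _∪_; _∩_; ∁; _─_; _-_; ⁅_⁆; ∣_∣; ⊥)
open import Data.Fin.Subset.Properties
  using ( _∈?_; nonempty?; drop-∷-⊆; p⊆q⇒∣p∣≤∣q∣; ∣⊥∣≡0; x∈⁅x⁆; x∈⁅y⁆⇒x≡y; x∉⁅y⁆⇒x≢y; x≢y⇒x∉⁅y⁆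
        ; p⊆p∪q; q⊆p∪q; x∈p∪q⁺; x∈p∪q⁻; ∪-assoc; ∪-comm; ∪-identityʳ
        ; p∩q⊆p; p∩q⊆q; x∈p∩q⁺; x∈p∩q⁻; x∉p⇒x∈∁p; x∈∁p⇒x∉p; x∈p⇒x∉∁p
        ; x∈p∧x∉q⇒x∈p─q; p─q⊆p)
open import Data.Fin.Subset.Induction using (Acc; acc; ⊂-wellFounded; ⊃-wellFounded)
open import Data.Vec using ([]; _∷_; tabulate; here; there)
open import Data.Vec.Properties using (lookup∘tabulate; []=⇒lookup; lookup⇒[]=)
open import Data.Product using (_×_; _,_; proj₁; proj₂; ∃-syntax)
open import Data.Sum using (_⊎_; inj₁; inj₂; [_,_]; swap)
open import Data.Empty using (⊥-elim)
open import Function using (_∘_; id)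
open import Function.Bundles using (_⇔_; mk⇔; Equivalence)
open import Level using (0ℓ)
open import Relation.Binary.PropositionalEquality
  using (_≡_; _≢_; refl; sym; trans; cong; subst; module ≡-Reasoning)
open import Relation.Nullary using (¬_; Dec; yes; no; does)
open import Relation.Nullary.Decidable using (_×-dec_; _⊎-dec_; ¬?; dec-true)
open import Relation.Unary using (Pred; Decidable)

private
  variable
    k : ℕ
    x y : Fin k
    p q s : Subset k

-- Finite subsets

module _ {P : Pred (Fin k) 0ℓ} (P? : Decidable P) where

  select : Subset k
  select = tabulate (does ∘ P?)

  ∈-select⁺ : P x → x ∈ select
  ∈-select⁺ {x} px = lookup⇒[]= x select (trans (lookup∘tabulate _ x) (dec-true (P? x) px))

  ∈-select⁻ : x ∈ select → P x
  ∈-select⁻ {x} x∈ with P? x | trans (sym (lookup∘tabulate (does ∘ P?) x)) ([]=⇒lookup x∈)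
  ... | yes px | _ = px

∪-⊆ : p ⊆ s → q ⊆ s → p ∪ q ⊆ s
∪-⊆ {p = p} {q = q} p⊆s q⊆s x∈ = [ p⊆s , q⊆s ] (x∈p∪q⁻ p q x∈)

x∈p⇒⁅x⁆⊆p : x ∈ p → ⁅ x ⁆ ⊆ p
x∈p⇒⁅x⁆⊆p {x = x} x∈p y∈ rewrite x∈⁅y⁆⇒x≡y x y∈ = x∈p

x∉p⇒p⊂p∪⁅x⁆ : x ∉ p → p ⊂ p ∪ ⁅ x ⁆
x∉p⇒p⊂p∪⁅x⁆ {x = x} x∉p = p⊆p∪q ⁅ x ⁆ , x , x∈p∪q⁺ (inj₂ (x∈⁅x⁆ x)) , x∉p

x∈p─q⇒x∉q : ∀ (p q : Subset k) → x ∈ p ─ q → x ∉ q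
x∈p─q⇒x∉q (true  ∷ p) (true ∷ q) ()        here
x∈p─q⇒x∉q (false ∷ p) (true ∷ q) ()        here
x∈p─q⇒x∉q (_     ∷ p) (_    ∷ q) (there i) (there j) = x∈p─q⇒x∉q p q i j

x∈p-y⇒x≢y : x ∈ p - y → x ≢ y
x∈p-y⇒x≢y {p = p} {y = y} = x∉⁅y⁆⇒x≢y ∘ x∈p─q⇒x∉q p ⁅ y ⁆

∣p∪⁅x⁆∣≤1+∣p∣ : ∀ (p : Subset k) x → ∣ p ∪ ⁅ x ⁆ ∣ ≤ suc ∣ p ∣
∣p∪⁅x⁆∣≤1+∣p∣ (true  ∷ p) zero    rewrite ∪-identityʳ p = ℕ.n≤1+n _
∣p∪⁅x⁆∣≤1+∣p∣ (false ∷ p) zero    rewrite ∪-identityʳ p = ℕ.≤-refl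
∣p∪⁅x⁆∣≤1+∣p∣ (true  ∷ p) (suc x) = s≤s (∣p∪⁅x⁆∣≤1+∣p∣ p x)
∣p∪⁅x⁆∣≤1+∣p∣ (false ∷ p) (suc x) = ∣p∪⁅x⁆∣≤1+∣p∣ p x

p⊆q⇒∣p∣+∣q∩∁p∣≤∣q∣ : ∀ (p q : Subset k) → p ⊆ q → ∣ p ∣ + ∣ q ∩ ∁ p ∣ ≤ ∣ q ∣
p⊆q⇒∣p∣+∣q∩∁p∣≤∣q∣ []          []          _   = z≤n
p⊆q⇒∣p∣+∣q∩∁p∣≤∣q∣ (true  ∷ p) (true  ∷ q) p⊆q = s≤s (p⊆q⇒∣p∣+∣q∩∁p∣≤∣q∣ p q (drop-∷-⊆ p⊆q))
p⊆q⇒∣p∣+∣q∩∁p∣≤∣q∣ (true  ∷ p) (false ∷ q) p⊆q with () ← p⊆q here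
p⊆q⇒∣p∣+∣q∩∁p∣≤∣q∣ (false ∷ p) (true  ∷ q) p⊆q
  rewrite ℕ.+-suc ∣ p ∣ ∣ q ∩ ∁ p ∣ = s≤s (p⊆q⇒∣p∣+∣q∩∁p∣≤∣q∣ p q (drop-∷-⊆ p⊆q))
p⊆q⇒∣p∣+∣q∩∁p∣≤∣q∣ (false ∷ p) (false ∷ q) p⊆q = p⊆q⇒∣p∣+∣q∩∁p∣≤∣q∣ p q (drop-∷-⊆ p⊆q)

-- Matroids

module MatroidProperties {m} (M : RawMatroid m) (isM : IsMatroid M) where
  open IsMatroid isM

  r : Subset m → ℕ
  r = rank M

  rank-∪-≤ : ∀ {X Y} → X ⊆ ground M → Y ⊆ ground M → r (X ∪ Y) ≤ r X + r Y
  rank-∪-≤ {X} {Y} X⊆E Y⊆E = ℕ.≤-trans (ℕ.m≤m+n _ _) (rank-submod X Y X⊆E Y⊆E)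

  InClosure-mono : ∀ {A B x} → A ⊆ B → B ⊆ ground M → InClosure M A x → InClosure M B x
  InClosure-mono {A} {B} {x} A⊆B B⊆E (x∈E , rAx≡rA) = x∈E , ℕ.≤-antisym rBx≤rB rB≤rBx
    where
    open ≤-Reasoning
    Ax = A ∪ ⁅ x ⁆
    Ax⊆E : Ax ⊆ ground M
    Ax⊆E = ∪-⊆ (B⊆E ∘ A⊆B) (x∈p⇒⁅x⁆⊆p x∈E)
    rB≤rBx : r B ≤ r (B ∪ ⁅ x ⁆)
    rB≤rBx = rank-mono B (B ∪ ⁅ x ⁆) (∪-⊆ B⊆E (x∈p⇒⁅x⁆⊆p x∈E)) (p⊆p∪q ⁅ x ⁆)
    Bx⊆Ax∪B : B ∪ ⁅ x ⁆ ⊆ Ax ∪ B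
    Bx⊆Ax∪B = ∪-⊆ (q⊆p∪q Ax B) (x∈p⇒⁅x⁆⊆p (p⊆p∪q B (q⊆p∪q A ⁅ x ⁆ (x∈⁅x⁆ x))))
    A⊆Ax∩B : A ⊆ Ax ∩ B
    A⊆Ax∩B y∈A = x∈p∩q⁺ (p⊆p∪q ⁅ x ⁆ y∈A , A⊆B y∈A)
    rBx≤rB : r (B ∪ ⁅ x ⁆) ≤ r B
    rBx≤rB = ℕ.+-cancelʳ-≤ (r A) _ _ (begin
      r (B ∪ ⁅ x ⁆) + r A
        ≤⟨ ℕ.+-mono-≤ (rank-mono _ _ (∪-⊆ Ax⊆E B⊆E) Bx⊆Ax∪B)
                      (rank-mono _ _ (B⊆E ∘ p∩q⊆q Ax B) A⊆Ax∩B) ⟩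
      r (Ax ∪ B) + r (Ax ∩ B)  ≤⟨ rank-submod Ax B Ax⊆E B⊆E ⟩
      r Ax + r B               ≡⟨ cong (_+ r B) rAx≡rA ⟩
      r A + r B                ≡⟨ ℕ.+-comm (r A) (r B) ⟩
      r B + r A                ∎)

  InClosure-contract : ∀ {e X x} → e ∈ ground M → X ⊆ ground M →
                       InClosure (contract M e) X x → InClosure M (X ∪ ⁅ e ⁆) x
  InClosure-contract {e} {X} {x} e∈E X⊆E (x∈E-e , eq) =
    x∈E , trans (cong r Xex≡Xxe) (ℕ.∸-cancelʳ-≡ (re≤ (X ∪ ⁅ x ⁆) Xx⊆E) (re≤ X X⊆E) eq)
    where
    x∈E : x ∈ ground M
    x∈E = p─q⊆p (ground M) ⁅ e ⁆ x∈E-e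
    Xx⊆E : X ∪ ⁅ x ⁆ ⊆ ground M
    Xx⊆E = ∪-⊆ X⊆E (x∈p⇒⁅x⁆⊆p x∈E)
    re≤ : ∀ Y → Y ⊆ ground M → r ⁅ e ⁆ ≤ r (Y ∪ ⁅ e ⁆)
    re≤ Y Y⊆E = rank-mono _ _ (∪-⊆ Y⊆E (x∈p⇒⁅x⁆⊆p e∈E)) (q⊆p∪q Y ⁅ e ⁆)
    Xex≡Xxe : (X ∪ ⁅ e ⁆) ∪ ⁅ x ⁆ ≡ (X ∪ ⁅ x ⁆) ∪ ⁅ e ⁆
    Xex≡Xxe = begin
      (X ∪ ⁅ e ⁆) ∪ ⁅ x ⁆  ≡⟨ ∪-assoc X ⁅ e ⁆ ⁅ x ⁆ ⟩
      X ∪ (⁅ e ⁆ ∪ ⁅ x ⁆)  ≡⟨ cong (X ∪_) (∪-comm ⁅ e ⁆ ⁅ x ⁆) ⟩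
      X ∪ (⁅ x ⁆ ∪ ⁅ e ⁆)  ≡⟨ ∪-assoc X ⁅ x ⁆ ⁅ e ⁆ ⟨
      (X ∪ ⁅ x ⁆) ∪ ⁅ e ⁆  ∎
      where open ≡-Reasoning

rank-contract-≤ : ∀ {m} (M : RawMatroid m) {e X c} → ¬ IsMatroidLoop M e → e ∈ ground M →
                  rank M (X ∪ ⁅ e ⁆) ≤ suc c → rank (contract M e) X ≤ c
rank-contract-≤ M e-nonloop e∈E rXe≤ = ℕ.∸-mono rXe≤ (ℕ.n≢0⇒n>0 (e-nonloop ∘ (e∈E ,_)))

-- Graphs

module GraphProperties {n m} (G : Graph n m) where

  end₁ end₂ : Fin m → Fin n
  end₁ f = proj₁ (ends G f)
  end₂ f = proj₂ (ends G f)

  private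
    variable
      f : Fin m
      a b c w : Fin n
      U K : Subset n

  joins-ends : f ∈ edges G → Joins G f (end₁ f) (end₂ f)
  joins-ends f∈ = f∈ , inj₁ (refl , refl)

  joins-sym : Joins G f a b → Joins G f b a
  joins-sym (f∈ , inj₁ ends≡) = f∈ , inj₂ ends≡
  joins-sym (f∈ , inj₂ ends≡) = f∈ , inj₁ ends≡

  joins-verts : Joins G f a b → a ∈ verts G × b ∈ verts G
  joins-verts {f} (f∈ , inj₁ (refl , refl)) = ends-verts G f f∈
  joins-verts {f} (f∈ , inj₂ (refl , refl)) = proj₂ (ends-verts G f f∈) , proj₁ (ends-verts G f f∈)

  joins⇒incident : Joins G f a b → Incident G f b
  joins⇒incident (_ , inj₁ (_ , refl)) = inj₂ refl
  joins⇒incident (_ , inj₂ (refl , _)) = inj₁ refl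

  joins⇒incident⇔ : Joins G f a b → Incident G f w ⇔ (a ≡ w ⊎ b ≡ w)
  joins⇒incident⇔ (_ , inj₁ (refl , refl)) = mk⇔ id id
  joins⇒incident⇔ (_ , inj₂ (refl , refl)) = mk⇔ swap swap

  joins-self⇒loop : Joins G f a a → IsLoopAt G f a
  joins-self⇒loop (f∈ , inj₁ (p , q)) = f∈ , p , q
  joins-self⇒loop (f∈ , inj₂ (p , q)) = f∈ , p , q

  loop-incident : IsLoopAt G f c → Incident G f w → c ≡ w
  loop-incident (_ , p , _) (inj₁ p′) = trans (sym p) p′
  loop-incident (_ , _ , q) (inj₂ q′) = trans (sym q) q′

  loop⇒incident : IsLoopAt G f c → Incident G f c
  loop⇒incident (_ , p , _) = inj₁ p

  loop-vert : IsLoopAt G f c → c ∈ verts G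
  loop-vert {f} (f∈ , refl , _) = proj₁ (ends-verts G f f∈)

  incident? : ∀ f w → Dec (Incident G f w)
  incident? f w = (end₁ f ≟ w) ⊎-dec (end₂ f ≟ w)

  incident-∈ : end₁ f ∈ U → end₂ f ∈ U → Incident G f w → w ∈ U
  incident-∈ a∈ _  (inj₁ refl) = a∈
  incident-∈ _  b∈ (inj₂ refl) = b∈

  reach-trans : Reach G a b → Reach G b c → Reach G a c
  reach-trans (here _)     q = q
  reach-trans (step f j p) q = step f j (reach-trans p q)

  reach-sym : Reach G a b → Reach G b a
  reach-sym (here a∈)    = here a∈
  reach-sym (step f j p) =
    reach-trans (reach-sym p) (step f (joins-sym j) (here (proj₁ (joins-verts j))))

  Closed : Subset n → Set
  Closed U = ∀ f a b → Joins G f a b → a ∈ U → b ∈ U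

  data Leaving (U : Subset n) : Set where
    leaving : Joins G f a b → a ∈ U → b ∉ U → Leaving U

  Crosses : Subset n → Pred (Fin m) 0ℓ
  Crosses U f = f ∈ edges G × (end₁ f ∈ U × end₂ f ∉ U ⊎ end₂ f ∈ U × end₁ f ∉ U)

  crosses? : ∀ U → Decidable (Crosses U)
  crosses? U f = f ∈? edges G ×-dec ((end₁ f ∈? U ×-dec ¬? (end₂ f ∈? U))
                                ⊎-dec (end₂ f ∈? U ×-dec ¬? (end₁ f ∈? U)))

  closed-or-leaving : ∀ U → Closed U ⊎ Leaving U
  closed-or-leaving U with any? (crosses? U)
  ... | yes (f , f∈ , inj₁ (a∈ , b∉)) = inj₂ (leaving (joins-ends f∈) a∈ b∉)
  ... | yes (f , f∈ , inj₂ (b∈ , a∉)) = inj₂ (leaving (joins-sym (joins-ends f∈)) b∈ a∉)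
  ... | no no-crossing = inj₁ closed
    where
    closed : Closed U
    closed f a b j a∈ with b ∈? U | j
    ... | yes b∈ | _                       = b∈
    ... | no  b∉ | f∈ , inj₁ (refl , refl) = ⊥-elim (no-crossing (f , f∈ , inj₁ (a∈ , b∉)))
    ... | no  b∉ | f∈ , inj₂ (refl , refl) = ⊥-elim (no-crossing (f , f∈ , inj₂ (a∈ , b∉)))

  closed-reach : Closed U → Reach G a b → a ∈ U → b ∈ U
  closed-reach closed (here _)     a∈ = a∈
  closed-reach closed (step f j p) a∈ = closed-reach closed p (closed f _ _ j a∈)

  closed-∩∁ : Closed U → Closed K → Closed (U ∩ ∁ K)
  closed-∩∁ {U} {K} closedU closedK f a b j a∈ with x∈p∩q⁻ U (∁ K) a∈
  ... | a∈U , a∈∁K = x∈p∩q⁺ (closedU f a b j a∈U ,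
                             x∉p⇒x∈∁p (x∈∁p⇒x∉p a∈∁K ∘ closedK f b a (joins-sym j)))

  component-containing : ∀ {x} → x ∈ verts G → ∃[ K ] IsComponent G K × x ∈ K
  component-containing {x} x∈V =
    grow ⁅ x ⁆ (⊃-wellFounded _) (x∈p⇒⁅x⁆⊆p x∈V) (x∈⁅x⁆ x)
         (λ y∈ → subst (Reach G x) (sym (x∈⁅y⁆⇒x≡y x y∈)) (here x∈V))
    where
    grow : ∀ U → Acc _⊃_ U → U ⊆ verts G → x ∈ U → (∀ {y} → y ∈ U → Reach G x y) →
           ∃[ K ] IsComponent G K × x ∈ K
    grow U (acc rs) U⊆V x∈U reach with closed-or-leaving U
    ... | inj₁ closed = U , (U⊆V , (x , x∈U) , connected , closed) , x∈U
      where
      connected : ∀ a b → a ∈ U → b ∈ U → Reach G a b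
      connected a b a∈ b∈ = reach-trans (reach-sym (reach a∈)) (reach b∈)
    ... | inj₂ (leaving {f = f} {a} {b} j a∈ b∉) =
      grow (U ∪ ⁅ b ⁆) (rs (x∉p⇒p⊂p∪⁅x⁆ b∉)) (∪-⊆ U⊆V (x∈p⇒⁅x⁆⊆p b∈V)) (p⊆p∪q ⁅ b ⁆ x∈U)
           (λ {y} y∈ → [ reach , reach-b ] (x∈p∪q⁻ U ⁅ b ⁆ y∈))
      where
      b∈V = proj₂ (joins-verts j)
      reach-b : ∀ {y} → y ∈ ⁅ b ⁆ → Reach G x y
      reach-b y∈ rewrite x∈⁅y⁆⇒x≡y b y∈ = reach-trans (reach a∈) (step f j (here b∈V))

  component⊆closed : IsComponent G K → Closed U → x ∈ K → x ∈ U → K ⊆ U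
  component⊆closed {x = x} (_ , _ , connected , _) closed x∈K x∈U y∈K =
    closed-reach closed (connected x _ x∈K y∈K) x∈U

  OnVerts : Subset n → Pred (Fin m) 0ℓ
  OnVerts U f = f ∈ edges G × end₁ f ∈ U × end₂ f ∈ U

  onVerts? : ∀ U → Decidable (OnVerts U)
  onVerts? U f = f ∈? edges G ×-dec end₁ f ∈? U ×-dec end₂ f ∈? U

  edgeSetOn : Subset n → Subset m
  edgeSetOn U = select (onVerts? U)

  edgeSetOn-isEdgeSetOn : ∀ U → IsEdgeSetOn G U (edgeSetOn U)
  edgeSetOn-isEdgeSetOn U f =
    ∈-select⁻ (onVerts? U) , λ f∈ a∈ b∈ → ∈-select⁺ (onVerts? U) (f∈ , a∈ , b∈)

  Avoids : Fin n → Pred (Fin m) 0ℓ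
  Avoids w f = f ∈ edges G × ¬ Incident G f w

  avoids? : ∀ w → Decidable (Avoids w)
  avoids? w f = f ∈? edges G ×-dec ¬? (incident? f w)

  edgeSetDel : Fin n → Subset m
  edgeSetDel w = select (avoids? w)

  edgeSetDel-isEdgeSetDel : ∀ w → IsEdgeSetDel G w (edgeSetDel w)
  edgeSetDel-isEdgeSetDel w f = ∈-select⁻ (avoids? w) , λ f∈ ¬i → ∈-select⁺ (avoids? w) (f∈ , ¬i)

  edgeSetOn-mono : U ⊆ K → edgeSetOn U ⊆ edgeSetOn K
  edgeSetOn-mono U⊆K f∈ with ∈-select⁻ (onVerts? _) f∈
  ... | f∈G , a∈ , b∈ = ∈-select⁺ (onVerts? _) (f∈G , U⊆K a∈ , U⊆K b∈)

  joins⇒∈edgeSetOn : Joins G f a b → a ∈ U → b ∈ U → f ∈ edgeSetOn U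
  joins⇒∈edgeSetOn (f∈ , inj₁ (refl , refl)) a∈ b∈ = ∈-select⁺ (onVerts? _) (f∈ , a∈ , b∈)
  joins⇒∈edgeSetOn (f∈ , inj₂ (refl , refl)) a∈ b∈ = ∈-select⁺ (onVerts? _) (f∈ , b∈ , a∈)

  edgeSetOn⊆edgeSetDel : w ∉ U → edgeSetOn U ⊆ edgeSetDel w
  edgeSetOn⊆edgeSetDel w∉U f∈ with ∈-select⁻ (onVerts? _) f∈
  ... | f∈G , a∈ , b∈ = ∈-select⁺ (avoids? _) (f∈G , w∉U ∘ incident-∈ a∈ b∈)

  edgeSetOn-split : Closed K → edgeSetOn U ⊆ edgeSetOn K ∪ edgeSetOn (U ∩ ∁ K)
  edgeSetOn-split {K} {U} closedK {f} f∈ with ∈-select⁻ (onVerts? U) f∈ | end₁ f ∈? K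
  ... | f∈G , _ , _ | yes a∈K =
    p⊆p∪q _ (joins⇒∈edgeSetOn (joins-ends f∈G) a∈K (closedK f _ _ (joins-ends f∈G) a∈K))
  ... | f∈G , a∈U , b∈U | no a∉K =
    q⊆p∪q _ _ (∈-select⁺ (onVerts? _) (f∈G , x∈p∩q⁺ (a∈U , x∉p⇒x∈∁p a∉K) , x∈p∩q⁺ (b∈U , x∉p⇒x∈∁p b∉K)))
    where
    b∉K = a∉K ∘ closedK f _ _ (joins-sym (joins-ends f∈G))

-- Weak frameworks

module WeakFrameworkProperties {n m} (G : Graph n m) (M : RawMatroid m) (isM : IsMatroid M)
                               (wf : IsWeakFramework G M) where
  open GraphProperties G
  open MatroidProperties M isM
  open IsMatroid isM
  open IsWeakFramework wf

  edges⊆ground : edges G ⊆ ground M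
  edges⊆ground {f} = subst (f ∈_) same-edges

  edgeSetOn⊆ground : ∀ U → edgeSetOn U ⊆ ground M
  edgeSetOn⊆ground U = edges⊆ground ∘ proj₁ ∘ ∈-select⁻ (onVerts? U)

  edgeSetDel⊆ground : ∀ w → edgeSetDel w ⊆ ground M
  edgeSetDel⊆ground w = edges⊆ground ∘ proj₁ ∘ ∈-select⁻ (avoids? w)

  rank-edgeSetOn-closed : ∀ {U} → U ⊆ verts G → Closed U → r (edgeSetOn U) ≤ ∣ U ∣
  rank-edgeSetOn-closed {U} = go U (⊂-wellFounded U)
    where
    open ≤-Reasoning
    go : ∀ U → Acc _⊂_ U → U ⊆ verts G → Closed U → r (edgeSetOn U) ≤ ∣ U ∣
    go U (acc rs) U⊆V closedU with nonempty? U
    ... | no empty = begin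
      r (edgeSetOn U)  ≤⟨ rank-≤-card _ (edgeSetOn⊆ground U) ⟩
      ∣ edgeSetOn U ∣  ≤⟨ p⊆q⇒∣p∣≤∣q∣ EU⊆⊥ ⟩
      ∣ ⊥ {m} ∣        ≡⟨ ∣⊥∣≡0 m ⟩
      0                ≤⟨ z≤n ⟩
      ∣ U ∣            ∎
      where
      EU⊆⊥ : edgeSetOn U ⊆ ⊥
      EU⊆⊥ f∈ = ⊥-elim (empty (_ , proj₁ (proj₂ (∈-select⁻ (onVerts? U) f∈))))
    ... | yes (x , x∈U) with component-containing (U⊆V x∈U)
    ...   | K , K-comp@(_ , _ , _ , closedK) , x∈K = begin
      r (edgeSetOn U)                    ≤⟨ rank-mono _ _ (∪-⊆ EK⊆E EW⊆E) (edgeSetOn-split closedK) ⟩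
      r (edgeSetOn K ∪ edgeSetOn W)      ≤⟨ rank-∪-≤ EK⊆E EW⊆E ⟩
      r (edgeSetOn K) + r (edgeSetOn W)  ≤⟨ ℕ.+-mono-≤ rEK≤ rEW≤ ⟩
      ∣ K ∣ + ∣ W ∣                      ≤⟨ p⊆q⇒∣p∣+∣q∩∁p∣≤∣q∣ K U K⊆U ⟩
      ∣ U ∣                              ∎
      where
      W = U ∩ ∁ K
      EK⊆E = edgeSetOn⊆ground K
      EW⊆E = edgeSetOn⊆ground W
      K⊆U : K ⊆ U
      K⊆U = component⊆closed K-comp closedU x∈K x∈U
      rEK≤ : r (edgeSetOn K) ≤ ∣ K ∣
      rEK≤ = component-rank K _ K-comp (edgeSetOn-isEdgeSetOn K)
      W⊂U : W ⊂ U
      W⊂U = p∩q⊆p U (∁ K) , x , x∈U , x∈p⇒x∉∁p x∈K ∘ proj₂ ∘ x∈p∩q⁻ U (∁ K)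
      rEW≤ : r (edgeSetOn W) ≤ ∣ W ∣
      rEW≤ = go W (rs W⊂U) (U⊆V ∘ p∩q⊆p U (∁ K)) (closed-∩∁ closedU closedK)

  joining-edge-∉-closure : ∀ {f a b} → Joins G f a b → a ≢ b → ¬ InClosure M (edgeSetDel b) f
  joining-edge-∉-closure {b = b} j a≢b f∈cl
    with closure-cond b (edgeSetDel b) (proj₂ (joins-verts j)) (edgeSetDel-isEdgeSetDel b) _ f∈cl
  ... | inj₁ f∈Del  = proj₂ (∈-select⁻ (avoids? b) f∈Del) (joins⇒incident j)
  ... | inj₂ f-loop = a≢b (sym (loop-incident f-loop (joins⇒incident (joins-sym j))))

  rank-edgeSetOn-< : ∀ {f a b U} → Joins G f a b → a ∈ U → b ∉ U →
                     r (edgeSetOn U) < r (edgeSetOn (U ∪ ⁅ b ⁆))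
  rank-edgeSetOn-< {f} {a} {b} {U} j a∈ b∉ = begin-strict
    r (edgeSetOn U)            <⟨ ℕ.≤∧≢⇒< (rank-mono _ _ EUf⊆E (p⊆p∪q ⁅ f ⁆)) (f∉cl ∘ (f∈E ,_) ∘ sym) ⟩
    r (edgeSetOn U ∪ ⁅ f ⁆)    ≤⟨ rank-mono _ _ (edgeSetOn⊆ground _) EUf⊆EUb ⟩
    r (edgeSetOn (U ∪ ⁅ b ⁆))  ∎
    where
    open ≤-Reasoning
    f∈E : f ∈ ground M
    f∈E = edges⊆ground (proj₁ j)
    EUf⊆E : edgeSetOn U ∪ ⁅ f ⁆ ⊆ ground M
    EUf⊆E = ∪-⊆ (edgeSetOn⊆ground U) (x∈p⇒⁅x⁆⊆p f∈E)
    EUf⊆EUb : edgeSetOn U ∪ ⁅ f ⁆ ⊆ edgeSetOn (U ∪ ⁅ b ⁆)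
    EUf⊆EUb = ∪-⊆ (edgeSetOn-mono (p⊆p∪q ⁅ b ⁆))
                  (x∈p⇒⁅x⁆⊆p (joins⇒∈edgeSetOn j (p⊆p∪q ⁅ b ⁆ a∈) (q⊆p∪q U ⁅ b ⁆ (x∈⁅x⁆ b))))
    f∉cl : ¬ InClosure M (edgeSetOn U) f
    f∉cl = joining-edge-∉-closure j (λ { refl → b∉ a∈ })
         ∘ InClosure-mono (edgeSetOn⊆edgeSetDel b∉) (edgeSetDel⊆ground b)

  rank-edgeSetOn-≤ : ∀ {U} → U ⊆ verts G → r (edgeSetOn U) ≤ ∣ U ∣
  rank-edgeSetOn-≤ {U} = go U (⊃-wellFounded U)
    where
    open ≤-Reasoning
    go : ∀ U → Acc _⊃_ U → U ⊆ verts G → r (edgeSetOn U) ≤ ∣ U ∣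
    go U (acc rs) U⊆V with closed-or-leaving U
    ... | inj₁ closedU = rank-edgeSetOn-closed U⊆V closedU
    ... | inj₂ (leaving {b = b} j a∈ b∉) = ℕ.≤-pred (begin-strict
      r (edgeSetOn U)              <⟨ rank-edgeSetOn-< j a∈ b∉ ⟩
      r (edgeSetOn (U ∪ ⁅ b ⁆))    ≤⟨ go (U ∪ ⁅ b ⁆) (rs (x∉p⇒p⊂p∪⁅x⁆ b∉))
                                         (∪-⊆ U⊆V (x∈p⇒⁅x⁆⊆p (proj₂ (joins-verts j)))) ⟩
      ∣ U ∪ ⁅ b ⁆ ∣                ≤⟨ ∣p∪⁅x⁆∣≤1+∣p∣ U b ⟩
      suc ∣ U ∣                    ∎)

-- The graph G ∘ e

module CircProperties {n m} (G : Graph n m) (e : Fin m) (v : Fin n) (G' : Graph n m)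
                      (circ : IsCirc G e v G') where
  open GraphProperties G
  module G' = GraphProperties G'
  open IsCirc circ

  private
    variable
      f : Fin m
      w : Fin n

  edges-circ⁻ : f ∈ edges G' → f ∈ edges G × f ≢ e
  edges-circ⁻ {f} f∈ rewrite edges-eq = p─q⊆p (edges G) ⁅ e ⁆ f∈ , x∈p-y⇒x≢y f∈

  edges-circ⁺ : f ∈ edges G → f ≢ e → f ∈ edges G'
  edges-circ⁺ f∈ f≢e rewrite edges-eq = x∈p∧x∉q⇒x∈p─q f∈ (x≢y⇒x∉⁅y⁆ f≢e)

  verts-circ⁻ : w ∈ verts G' → w ∈ verts G × w ≢ v
  verts-circ⁻ {w} w∈ rewrite verts-eq = p─q⊆p (verts G) ⁅ v ⁆ w∈ , x∈p-y⇒x≢y w∈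

  incident-circ : f ∈ edges G → IsLoopAt G f v ⊎ (∀ {w} → w ≢ v → Incident G' f w ⇔ Incident G f w)
  incident-circ {f} f∈ with end₁ f ≟ v | end₂ f ≟ v
  ... | yes p | yes q = inj₁ (f∈ , p , q)
  ... | yes p | no q  = inj₂ λ w≢v → mk⇔
    (inj₂ ∘ G'.loop-incident loop)
    [ (λ end₁≡w → ⊥-elim (w≢v (trans (sym end₁≡w) p))) , (λ { refl → G'.loop⇒incident loop }) ]
    where loop = to-loop f (end₂ f) (f∈ , inj₁ (p , refl)) q
  ... | no p  | yes q = inj₂ λ w≢v → mk⇔
    (inj₁ ∘ G'.loop-incident loop)
    [ (λ { refl → G'.loop⇒incident loop }) , (λ end₂≡w → ⊥-elim (w≢v (trans (sym end₂≡w) q))) ]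
    where loop = to-loop f (end₁ f) (f∈ , inj₂ (refl , q)) p
  ... | no p  | no q  = inj₂ λ _ → G'.joins⇒incident⇔ (keep f f∈ [ p , q ] _ _ (joins-ends f∈))

  incident-circ⁺ : f ∈ edges G → w ≢ v → Incident G f w → Incident G' f w
  incident-circ⁺ f∈ w≢v i with incident-circ f∈
  ... | inj₁ loop = ⊥-elim (w≢v (sym (loop-incident loop i)))
  ... | inj₂ same = Equivalence.from (same w≢v) i

  newly-incident⇒loop : f ∈ edges G → f ≢ e → w ≢ v → ¬ Incident G f w → Incident G' f w →
                        IsLoopAt G' f w
  newly-incident⇒loop {f} f∈ f≢e w≢v ¬i i′ with incident-circ f∈
  ... | inj₂ same = ⊥-elim (¬i (Equivalence.to (same w≢v) i′))
  ... | inj₁ loop with move-loop f loop f≢e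
  ...   | _ , loop′ = subst (IsLoopAt G' f) (G'.loop-incident loop′ i′) loop′

  loop-circ : w ≢ v → IsLoopAt G f w → IsLoopAt G' f w
  loop-circ {f = f} w≢v loop@(f∈ , p , q) =
    G'.joins-self⇒loop (keep f f∈ (w≢v ∘ loop-incident loop) _ _ (f∈ , inj₁ (p , q)))

  edgeSetOn-circ : IsLoopAt G e v → ∀ {C X} → IsEdgeSetOn G' C X → X ∪ ⁅ e ⁆ ⊆ edgeSetOn (C ∪ ⁅ v ⁆)
  edgeSetOn-circ e-loop {C} {X} onC = ∪-⊆ X⊆ (x∈p⇒⁅x⁆⊆p e∈)
    where
    v∈ : v ∈ C ∪ ⁅ v ⁆
    v∈ = q⊆p∪q C ⁅ v ⁆ (x∈⁅x⁆ v)
    e∈ : e ∈ edgeSetOn (C ∪ ⁅ v ⁆)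
    e∈ = joins⇒∈edgeSetOn (proj₁ e-loop , inj₁ (proj₂ e-loop)) v∈ v∈
    end∈ : ∀ {f w} → f ∈ X → Incident G f w → w ∈ C ∪ ⁅ v ⁆
    end∈ {f} {w} f∈X i with w ≟ v | proj₁ (onC f) f∈X
    ... | yes refl | _                  = v∈
    ... | no  w≢v  | f∈G' , a∈C , b∈C =
      p⊆p∪q ⁅ v ⁆ (G'.incident-∈ a∈C b∈C (incident-circ⁺ (proj₁ (edges-circ⁻ f∈G')) w≢v i))
    X⊆ : X ⊆ edgeSetOn (C ∪ ⁅ v ⁆)
    X⊆ {f} f∈X = ∈-select⁺ (onVerts? _) (f∈G , end∈ f∈X (inj₁ refl) , end∈ f∈X (inj₂ refl))
      where f∈G = proj₁ (edges-circ⁻ (proj₁ (proj₁ (onC f) f∈X)))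

  edgeSetDel-circ : IsLoopAt G e v → ∀ {u X} → u ≢ v → IsEdgeSetDel G' u X →
                    X ∪ ⁅ e ⁆ ⊆ edgeSetDel u
  edgeSetDel-circ e-loop u≢v delX = ∪-⊆ X⊆
    (x∈p⇒⁅x⁆⊆p (∈-select⁺ (avoids? _) (proj₁ e-loop , u≢v ∘ sym ∘ loop-incident e-loop)))
    where
    X⊆ : _ ⊆ edgeSetDel _
    X⊆ {f} f∈X with proj₁ (delX f) f∈X
    ... | f∈G' , ¬i′ = ∈-select⁺ (avoids? _) (f∈G , ¬i′ ∘ incident-circ⁺ f∈G u≢v)
      where f∈G = proj₁ (edges-circ⁻ f∈G')

module CircFramework {n m} (G : Graph n m) (M : RawMatroid m) (isM : IsMatroid M)
                     (wf : IsWeakFramework G M) (e : Fin m) (v : Fin n)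
                     (e-loop : IsLoopAt G e v) (e-nonloop : ¬ IsMatroidLoop M e)
                     (G' : Graph n m) (circ : IsCirc G e v G') where
  open GraphProperties G
  open MatroidProperties M isM
  open WeakFrameworkProperties G M isM wf
  open CircProperties G e v G' circ
  open IsMatroid isM
  open IsWeakFramework wf

  e∈E : e ∈ ground M
  e∈E = edges⊆ground (proj₁ e-loop)

  circ-same-edges : edges G' ≡ ground (contract M e)
  circ-same-edges = trans (IsCirc.edges-eq circ) (cong (_- e) same-edges)

  circ-component-rank : ∀ C X → IsComponent G' C → IsEdgeSetOn G' C X →
                        rank (contract M e) X ≤ ∣ C ∣
  circ-component-rank C X (C⊆V' , _) onC = rank-contract-≤ M e-nonloop e∈E (begin
    r (X ∪ ⁅ e ⁆)              ≤⟨ rank-mono _ _ (edgeSetOn⊆ground _) (edgeSetOn-circ e-loop onC) ⟩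
    r (edgeSetOn (C ∪ ⁅ v ⁆))  ≤⟨ rank-edgeSetOn-≤ Cv⊆V ⟩
    ∣ C ∪ ⁅ v ⁆ ∣              ≤⟨ ∣p∪⁅x⁆∣≤1+∣p∣ C v ⟩
    suc ∣ C ∣                  ∎)
    where
    open ≤-Reasoning
    Cv⊆V : C ∪ ⁅ v ⁆ ⊆ verts G
    Cv⊆V = ∪-⊆ (proj₁ ∘ verts-circ⁻ ∘ C⊆V') (x∈p⇒⁅x⁆⊆p (loop-vert e-loop))

  circ-closure-cond : ∀ u X → u ∈ verts G' → IsEdgeSetDel G' u X →
                      ∀ x → InClosure (contract M e) X x → x ∈ X ⊎ IsLoopAt G' x u
  circ-closure-cond u X u∈V' delX x x∈cl/e =
    [ from-G-u ∘ ∈-select⁻ (avoids? u) , inj₂ ∘ loop-circ u≢v ]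
      (closure-cond u (edgeSetDel u) u∈V (edgeSetDel-isEdgeSetDel u) x x∈cl)
    where
    u∈V = proj₁ (verts-circ⁻ u∈V')
    u≢v = proj₂ (verts-circ⁻ u∈V')
    x≢e : x ≢ e
    x≢e = x∈p-y⇒x≢y (proj₁ x∈cl/e)
    X⊆E : X ⊆ ground M
    X⊆E {f} = edges⊆ground ∘ proj₁ ∘ edges-circ⁻ ∘ proj₁ ∘ proj₁ (delX f)
    x∈cl : InClosure M (edgeSetDel u) x
    x∈cl = InClosure-mono (edgeSetDel-circ e-loop u≢v delX) (edgeSetDel⊆ground u)
                          (InClosure-contract e∈E X⊆E x∈cl/e)
    from-G-u : Avoids u x → x ∈ X ⊎ IsLoopAt G' x u
    from-G-u (x∈G , ¬i) with G'.incident? x u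
    ... | yes i′ = inj₂ (newly-incident⇒loop x∈G x≢e u≢v ¬i i′)
    ... | no ¬i′ = inj₁ (proj₂ (delX x) (edges-circ⁺ x∈G x≢e) ¬i′)

lemma2p9 : ∀ {n m} (G : Graph n m) (M : RawMatroid m) → IsMatroid M →
    IsWeakFramework G M →
    ∀ (e : Fin m) (v : Fin n) → IsLoopAt G e v → ¬ IsMatroidLoop M e →
    ∀ (G' : Graph n m) → IsCirc G e v G' → IsWeakFramework G' (contract M e)
lemma2p9 G M isM wf e v e-loop e-nonloop G' circ = record
  { same-edges     = circ-same-edges
  ; component-rank = circ-component-rank
  ; closure-cond   = circ-closure-cond
  }
  where open CircFramework G M isM wf e v e-loop e-nonloop G' circ
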